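{- If a raw type theory derives that $\Theta$ is a well-formed metavariable context, that $\Gamma$ is a well-formed variable context over $\Theta$, and $\Theta;\Gamma\vdash\mathcal{B}[e]$, then it derives $\Theta;\Gamma\vdash\mathcal{B}$.
   Context: Setting: finitary type theories with hypothetical judgements $\Theta;\Gamma\vdash\mathcal{J}$ (metavariable context $\Theta$, variable context $\Gamma$, abstracted judgement $\mathcal{J}$). A boundary $\mathcal{B}$ is a judgement with its head replaced by a placeholder: $\Box\ \mathsf{type}$, $\Box:A$, $A\equiv B$ by $\Box$, $s\equiv t:A$ by $\Box$, possibly under abstractions $\{x:A\}\mathcal{B}$; $\mathcal{B}[e]$ fills the placeholder with head $e$, and every judgement is uniquely of this form. Boundaries are derived by: $\Box\ \mathsf{type}$ always; $\Box:A$ from $A\ \mathsf{type}$; $A\equiv B$ by $\Box$ from $A\ \mathsf{type}$ and $B\ \mathsf{type}$; $s\equiv t:A$ by $\Box$ from $A\ \mathsf{type}$, $s:A$, $t:A$; and an abstraction rule. Well-formedness: the empty metavariable context is well-formed, and $\Theta,\mathsf{M}:\mathcal{B}$ is well-formed if $\Theta$ is, $\Theta;\emptyset\vdash\mathcal{B}$ and $\mathsf{M}$ is fresh; the empty variable context is well-formed over $\Theta$, and $\Gamma,\mathsf{a}:A$ is well-formed if $\Gamma$ is, $\Theta;\Gamma\vdash A\ \mathsf{type}$ and $\mathsf{a}$ is fresh. A raw type theory is a family of raw rules with deductive system given by structural rules, instantiations of specific rules (which include the instantiated conclusion boundary as a premise), and congruence rules for specific object rules. -}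

module Defs where

-- Raw syntax and deductive system of finitary type theories (with contexts),
-- following Haselwarter–Bauer, "Finitary type theories with and without contexts".
-- Variables are well-scoped de Bruijn indices (index 0 = most recently bound),
-- so freshness side conditions are automatic.  Metavariables are referred to by
-- membership proofs in the list of metavariable arities.

open import Data.Nat using (ℕ; zero; suc)
open import Data.Fin using (Fin; zero; suc)
open import Data.List using (List; []; _∷_)
open import Data.List.Membership.Propositional using (_∈_)
open import Data.List.Relation.Unary.Any using (here; there)
open import Data.List.Relation.Unary.All using (All; []; _∷_; lookup)
open import Data.Vec using (Vec; []; _∷_)
open import Data.Product using (Σ; _×_; _,_; proj₁; proj₂)
open import Data.Unit using (⊤; tt)
open import Relation.Binary.PropositionalEquality using (_≡_; refl)

data Cls : Set where
  ty tm : Cls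

-- judgement forms: obj ty = "_ type", obj tm = "_ : A",
-- eq ty = "A ≡ B", eq tm = "s ≡ t : A"
data Form : Set where
  obj eq : Cls → Form

-- arity of a metavariable (= of a boundary): its form and number of abstractions
MArity : Set
MArity = Form × ℕ

-- a signature: symbols with a syntactic class and a list of (object) argument
-- arities (class of the argument, number of variables it binds)
record Signature : Set₁ where
  field
    Sym     : Set
    symCls  : Sym → Cls
    symArgs : Sym → List (Cls × ℕ)
open Signature public

-- scope after binding k further variables (arranged so that binding one more
-- variable on the outside computes)
_⊕_ : ℕ → ℕ → ℕ
n ⊕ zero  = n
n ⊕ suc k = suc n ⊕ k

variable
  𝕊 : Signature
  ms ms' sh : List MArity
  n m j k : ℕ
  c : Cls
  f : Form

mutual
  data Expr (𝕊 : Signature) (ms : List MArity) (n : ℕ) : Cls → Set where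
    var  : Fin n → Expr 𝕊 ms n tm
    sym  : (s : Sym 𝕊) → Args 𝕊 ms n (symArgs 𝕊 s) → Expr 𝕊 ms n (symCls 𝕊 s)
    meta : ∀ {c k} → (obj c , k) ∈ ms → Vec (Expr 𝕊 ms n tm) k → Expr 𝕊 ms n c

  data Args (𝕊 : Signature) (ms : List MArity) (n : ℕ) : List (Cls × ℕ) → Set where
    []  : Args 𝕊 ms n []
    _∷_ : ∀ {c k as} → Expr 𝕊 ms (n ⊕ k) c → Args 𝕊 ms n as → Args 𝕊 ms n ((c , k) ∷ as)

Ren : ℕ → ℕ → Set
Ren n m = Fin n → Fin m

liftR : Ren n m → Ren (suc n) (suc m)
liftR ρ zero    = zero
liftR ρ (suc i) = suc (ρ i)

liftR⊕ : ∀ k → Ren n m → Ren (n ⊕ k) (m ⊕ k)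
liftR⊕ zero    ρ = ρ
liftR⊕ (suc k) ρ = liftR⊕ k (liftR ρ)

wk⊕ : ∀ k → Ren m (m ⊕ k)
wk⊕ zero    i = i
wk⊕ (suc k) i = wk⊕ k (suc i)

mutual
  ren : Ren n m → Expr 𝕊 ms n c → Expr 𝕊 ms m c
  ren ρ (var i)     = var (ρ i)
  ren ρ (sym s as)  = sym s (renArgs ρ as)
  ren ρ (meta p ts) = meta p (renVec ρ ts)

  renArgs : ∀ {as} → Ren n m → Args 𝕊 ms n as → Args 𝕊 ms m as
  renArgs ρ []               = []
  renArgs ρ (_∷_ {k = k} e as) = ren (liftR⊕ k ρ) e ∷ renArgs ρ as

  renVec : Ren n m → Vec (Expr 𝕊 ms n tm) k → Vec (Expr 𝕊 ms m tm) k
  renVec ρ []       = []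
  renVec ρ (t ∷ ts) = ren ρ t ∷ renVec ρ ts

Sub : Signature → List MArity → ℕ → ℕ → Set
Sub 𝕊 ms n m = Fin n → Expr 𝕊 ms m tm

emptyS : Sub 𝕊 ms 0 m
emptyS ()

_▸_ : Expr 𝕊 ms m tm → Sub 𝕊 ms n m → Sub 𝕊 ms (suc n) m
(t ▸ σ) zero    = t
(t ▸ σ) (suc i) = σ i

-- σ extended by t₁ … tₖ (t₁ for the outermost of the k new variables)
extend⋆ : Sub 𝕊 ms n m → Vec (Expr 𝕊 ms m tm) k → Sub 𝕊 ms (n ⊕ k) m
extend⋆ σ []       = σ
extend⋆ σ (t ∷ ts) = extend⋆ (t ▸ σ) ts

liftS : Sub 𝕊 ms n m → Sub 𝕊 ms (suc n) (suc m)
liftS σ zero    = var zero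
liftS σ (suc i) = ren suc (σ i)

liftS⊕ : ∀ k → Sub 𝕊 ms n m → Sub 𝕊 ms (n ⊕ k) (m ⊕ k)
liftS⊕ zero    σ = σ
liftS⊕ (suc k) σ = liftS⊕ k (liftS σ)

wkS : ∀ k → Sub 𝕊 ms n m → Sub 𝕊 ms n (m ⊕ k)
wkS k σ i = ren (wk⊕ k) (σ i)

mutual
  sub : Sub 𝕊 ms n m → Expr 𝕊 ms n c → Expr 𝕊 ms m c
  sub σ (var i)     = σ i
  sub σ (sym s as)  = sym s (subArgs σ as)
  sub σ (meta p ts) = meta p (subVec σ ts)

  subArgs : ∀ {as} → Sub 𝕊 ms n m → Args 𝕊 ms n as → Args 𝕊 ms m as
  subArgs σ []                 = []
  subArgs σ (_∷_ {k = k} e as) = sub (liftS⊕ k σ) e ∷ subArgs σ as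

  subVec : Sub 𝕊 ms n m → Vec (Expr 𝕊 ms n tm) k → Vec (Expr 𝕊 ms m tm) k
  subVec σ []       = []
  subVec σ (t ∷ ts) = sub σ t ∷ subVec σ ts

MRen : List MArity → List MArity → Set
MRen ms ms' = ∀ {a} → a ∈ ms → a ∈ ms'

mutual
  mren : MRen ms ms' → Expr 𝕊 ms n c → Expr 𝕊 ms' n c
  mren θ (var i)     = var i
  mren θ (sym s as)  = sym s (mrenArgs θ as)
  mren θ (meta p ts) = meta (θ p) (mrenVec θ ts)

  mrenArgs : ∀ {as} → MRen ms ms' → Args 𝕊 ms n as → Args 𝕊 ms' n as
  mrenArgs θ []       = []
  mrenArgs θ (e ∷ as) = mren θ e ∷ mrenArgs θ as

  mrenVec : MRen ms ms' → Vec (Expr 𝕊 ms n tm) k → Vec (Expr 𝕊 ms' n tm) k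
  mrenVec θ []       = []
  mrenVec θ (t ∷ ts) = mren θ t ∷ mrenVec θ ts

data BBdry (𝕊 : Signature) (ms : List MArity) (n : ℕ) : Form → Set where
  bTy   : BBdry 𝕊 ms n (obj ty)
  bTm   : Expr 𝕊 ms n ty → BBdry 𝕊 ms n (obj tm)
  bEqTy : Expr 𝕊 ms n ty → Expr 𝕊 ms n ty → BBdry 𝕊 ms n (eq ty)
  bEqTm : Expr 𝕊 ms n tm → Expr 𝕊 ms n tm → Expr 𝕊 ms n ty → BBdry 𝕊 ms n (eq tm)

data Bdry (𝕊 : Signature) (ms : List MArity) : ℕ → MArity → Set where
  bbase : BBdry 𝕊 ms n f → Bdry 𝕊 ms n (f , 0)
  babs  : Expr 𝕊 ms n ty → Bdry 𝕊 ms (suc n) (f , k) → Bdry 𝕊 ms n (f , suc k)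

Head : Signature → List MArity → ℕ → Form → Set
Head 𝕊 ms n (obj c) = Expr 𝕊 ms n c
Head 𝕊 ms n (eq c)  = ⊤

data BJdg (𝕊 : Signature) (ms : List MArity) (n : ℕ) : Form → Set where
  jTy   : Expr 𝕊 ms n ty → BJdg 𝕊 ms n (obj ty)
  jTm   : Expr 𝕊 ms n tm → Expr 𝕊 ms n ty → BJdg 𝕊 ms n (obj tm)
  jEqTy : Expr 𝕊 ms n ty → Expr 𝕊 ms n ty → BJdg 𝕊 ms n (eq ty)
  jEqTm : Expr 𝕊 ms n tm → Expr 𝕊 ms n tm → Expr 𝕊 ms n ty → BJdg 𝕊 ms n (eq tm)

data Jdg (𝕊 : Signature) (ms : List MArity) : ℕ → MArity → Set where
  jbase : BJdg 𝕊 ms n f → Jdg 𝕊 ms n (f , 0)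
  jabs  : Expr 𝕊 ms n ty → Jdg 𝕊 ms (suc n) (f , k) → Jdg 𝕊 ms n (f , suc k)

fillB : BBdry 𝕊 ms n f → Head 𝕊 ms n f → BJdg 𝕊 ms n f
fillB bTy             e = jTy e
fillB (bTm A)         e = jTm e A
fillB (bEqTy A B)     _ = jEqTy A B
fillB (bEqTm s t A)   _ = jEqTm s t A

fill : Bdry 𝕊 ms n (f , k) → Head 𝕊 ms (n ⊕ k) f → Jdg 𝕊 ms n (f , k)
fill (bbase b)  e = jbase (fillB b e)
fill (babs A B) e = jabs A (fill B e)

body : Bdry 𝕊 ms n (f , k) → BBdry 𝕊 ms (n ⊕ k) f
body (bbase b)  = b
body (babs A B) = body B

tyOf : BBdry 𝕊 ms n (obj tm) → Expr 𝕊 ms n ty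
tyOf (bTm A) = A

eqBJ : BBdry 𝕊 ms n (obj c) → Expr 𝕊 ms n c → Expr 𝕊 ms n c → BJdg 𝕊 ms n (eq c)
eqBJ bTy     e₁ e₂ = jEqTy e₁ e₂
eqBJ (bTm C) e₁ e₂ = jEqTm e₁ e₂ C

eqJ : Bdry 𝕊 ms n (obj c , k) → Expr 𝕊 ms (n ⊕ k) c → Expr 𝕊 ms (n ⊕ k) c → Jdg 𝕊 ms n (eq c , k)
eqJ (bbase b)  e₁ e₂ = jbase (eqBJ b e₁ e₂)
eqJ (babs A B) e₁ e₂ = jabs A (eqJ B e₁ e₂)

subBB : Sub 𝕊 ms n m → BBdry 𝕊 ms n f → BBdry 𝕊 ms m f
subBB σ bTy           = bTy
subBB σ (bTm A)       = bTm (sub σ A)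
subBB σ (bEqTy A B)   = bEqTy (sub σ A) (sub σ B)
subBB σ (bEqTm s t A) = bEqTm (sub σ s) (sub σ t) (sub σ A)

mrenBB : MRen ms ms' → BBdry 𝕊 ms n f → BBdry 𝕊 ms' n f
mrenBB θ bTy           = bTy
mrenBB θ (bTm A)       = bTm (mren θ A)
mrenBB θ (bEqTy A B)   = bEqTy (mren θ A) (mren θ B)
mrenBB θ (bEqTm s t A) = bEqTm (mren θ s) (mren θ t) (mren θ A)

mrenB : ∀ {a} → MRen ms ms' → Bdry 𝕊 ms n a → Bdry 𝕊 ms' n a
mrenB θ (bbase b)  = bbase (mrenBB θ b)
mrenB θ (babs A B) = babs (mren θ A) (mrenB θ B)

data MCtx (𝕊 : Signature) : List MArity → Set where
  ∅ᵐ   : MCtx 𝕊 []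
  _▷ᵐ_ : ∀ {a} → MCtx 𝕊 ms → Bdry 𝕊 ms 0 a → MCtx 𝕊 (a ∷ ms)

lookupM : ∀ {a} → MCtx 𝕊 ms → a ∈ ms → Bdry 𝕊 ms 0 a
lookupM (Θ ▷ᵐ B) (here refl) = mrenB there B
lookupM (Θ ▷ᵐ B) (there p)   = mrenB there (lookupM Θ p)

data VCtx (𝕊 : Signature) (ms : List MArity) : ℕ → Set where
  ∅ᵛ   : VCtx 𝕊 ms 0
  _▷ᵛ_ : VCtx 𝕊 ms n → Expr 𝕊 ms n ty → VCtx 𝕊 ms (suc n)

lookupV : VCtx 𝕊 ms n → Fin n → Expr 𝕊 ms n ty
lookupV (Γ ▷ᵛ A) zero    = ren suc A
lookupV (Γ ▷ᵛ A) (suc i) = ren suc (lookupV Γ i)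

-- Instantiations of a metavariable context (of shape sh) over Θ;Γ (|Γ| = n):
-- an abstracted head for every metavariable

Inst : Signature → List MArity → List MArity → ℕ → Set
Inst 𝕊 sh ms n = All (λ a → Head 𝕊 ms (n ⊕ proj₂ a) (proj₁ a)) sh

-- I_* applied to an expression; ρ interprets the free variables of I,
-- σ the variables of the expression
mutual
  instE : Inst 𝕊 sh ms n → Sub 𝕊 ms n m → Sub 𝕊 ms j m → Expr 𝕊 sh j c → Expr 𝕊 ms m c
  instE I ρ σ (var i)     = σ i
  instE I ρ σ (sym s as)  = sym s (instArgs I ρ σ as)
  instE I ρ σ (meta p ts) = sub (extend⋆ ρ (instVec I ρ σ ts)) (lookup I p)

  instArgs : ∀ {as} → Inst 𝕊 sh ms n → Sub 𝕊 ms n m → Sub 𝕊 ms j m → Args 𝕊 sh j as → Args 𝕊 ms m as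
  instArgs I ρ σ []                 = []
  instArgs I ρ σ (_∷_ {k = k} e as) = instE I (wkS k ρ) (liftS⊕ k σ) e ∷ instArgs I ρ σ as

  instVec : Inst 𝕊 sh ms n → Sub 𝕊 ms n m → Sub 𝕊 ms j m → Vec (Expr 𝕊 sh j tm) k → Vec (Expr 𝕊 ms m tm) k
  instVec I ρ σ []       = []
  instVec I ρ σ (t ∷ ts) = instE I ρ σ t ∷ instVec I ρ σ ts

instBB : Inst 𝕊 sh ms n → Sub 𝕊 ms n m → Sub 𝕊 ms j m → BBdry 𝕊 sh j f → BBdry 𝕊 ms m f
instBB I ρ σ bTy           = bTy
instBB I ρ σ (bTm A)       = bTm (instE I ρ σ A)
instBB I ρ σ (bEqTy A B)   = bEqTy (instE I ρ σ A) (instE I ρ σ B)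
instBB I ρ σ (bEqTm s t A) = bEqTm (instE I ρ σ s) (instE I ρ σ t) (instE I ρ σ A)

instB : ∀ {a} → Inst 𝕊 sh ms n → Sub 𝕊 ms n m → Sub 𝕊 ms j m → Bdry 𝕊 sh j a → Bdry 𝕊 ms m a
instB I ρ σ (bbase b)  = bbase (instBB I ρ σ b)
instB I ρ σ (babs A B) = babs (instE I ρ σ A) (instB I (wkS 1 ρ) (liftS σ) B)

instBJ : Inst 𝕊 sh ms n → Sub 𝕊 ms n m → Sub 𝕊 ms j m → BJdg 𝕊 sh j f → BJdg 𝕊 ms m f
instBJ I ρ σ (jTy A)       = jTy (instE I ρ σ A)
instBJ I ρ σ (jTm t A)     = jTm (instE I ρ σ t) (instE I ρ σ A)
instBJ I ρ σ (jEqTy A B)   = jEqTy (instE I ρ σ A) (instE I ρ σ B)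
instBJ I ρ σ (jEqTm s t A) = jEqTm (instE I ρ σ s) (instE I ρ σ t) (instE I ρ σ A)

I⋆ : Inst 𝕊 sh ms n → Expr 𝕊 sh 0 c → Expr 𝕊 ms n c
I⋆ I = instE I var emptyS

I⋆B : ∀ {a} → Inst 𝕊 sh ms n → Bdry 𝕊 sh 0 a → Bdry 𝕊 ms n a
I⋆B I = instB I var emptyS

I⋆BB : Inst 𝕊 sh ms n → BBdry 𝕊 sh 0 f → BBdry 𝕊 ms n f
I⋆BB I = instBB I var emptyS

I⋆BJ : Inst 𝕊 sh ms n → BJdg 𝕊 sh 0 f → BJdg 𝕊 ms n f
I⋆BJ I = instBJ I var emptyS

record RawRule (𝕊 : Signature) : Set where
  field
    shape : List MArity
    prem  : MCtx 𝕊 shape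
    form  : Form
    bdry  : BBdry 𝕊 shape 0 form
    head  : Head 𝕊 shape 0 form
open RawRule public

record RawTT (𝕊 : Signature) : Set₁ where
  field
    Rule : Set
    rule : Rule → RawRule 𝕊
open RawTT public

-- the conclusion (form, boundary, head) of a rule, to express
-- "R is an object rule with conclusion b[e]"
concl : (R : RawRule 𝕊) → Σ Form (λ f → BBdry 𝕊 (shape R) 0 f × Head 𝕊 (shape R) 0 f)
concl R = form R , bdry R , head R

mutual
  data Derives (T : RawTT 𝕊) (Θ : MCtx 𝕊 ms) : VCtx 𝕊 ms n → Jdg 𝕊 ms n (f , k) → Set where
    var-rule : ∀ {Γ : VCtx 𝕊 ms n} (i : Fin n) →
      Derives T Θ Γ (jbase (jTm (var i) (lookupV Γ i)))
    meta-rule : ∀ {Γ : VCtx 𝕊 ms n} (p : (f , k) ∈ ms) (ts : Vec (Expr 𝕊 ms n tm) k) →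
      ArgSpine T Θ Γ (lookupM Θ p) emptyS ts →
      DerivesB T Θ Γ (bbase (subBB (extend⋆ emptyS ts) (body (lookupM Θ p)))) →
      Derives T Θ Γ (jbase (fillB (subBB (extend⋆ emptyS ts) (body (lookupM Θ p))) (mhead p ts)))
    meta-congr-ty : ∀ {Γ : VCtx 𝕊 ms n} (p : (obj ty , k) ∈ ms) (ss ts : Vec (Expr 𝕊 ms n tm) k) →
      ArgSpine T Θ Γ (lookupM Θ p) emptyS ss →
      ArgSpine T Θ Γ (lookupM Θ p) emptyS ts →
      EqSpine T Θ Γ (lookupM Θ p) emptyS ss ts →
      Derives T Θ Γ (jbase (jEqTy (meta p ss) (meta p ts)))
    meta-congr-tm : ∀ {Γ : VCtx 𝕊 ms n} (p : (obj tm , k) ∈ ms) (ss ts : Vec (Expr 𝕊 ms n tm) k) →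
      ArgSpine T Θ Γ (lookupM Θ p) emptyS ss →
      ArgSpine T Θ Γ (lookupM Θ p) emptyS ts →
      EqSpine T Θ Γ (lookupM Θ p) emptyS ss ts →
      Derives T Θ Γ (jbase (jEqTy (sub (extend⋆ emptyS ss) (tyOf (body (lookupM Θ p))))
                                  (sub (extend⋆ emptyS ts) (tyOf (body (lookupM Θ p)))))) →
      Derives T Θ Γ (jbase (jEqTm (meta p ss) (meta p ts) (sub (extend⋆ emptyS ss) (tyOf (body (lookupM Θ p))))))
    abstr : ∀ {Γ : VCtx 𝕊 ms n} {A : Expr 𝕊 ms n ty} {J : Jdg 𝕊 ms (suc n) (f , k)} →
      Derives T Θ Γ (jbase (jTy A)) →
      Derives T Θ (Γ ▷ᵛ A) J →
      Derives T Θ Γ (jabs A J)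
    eqTy-refl : ∀ {Γ : VCtx 𝕊 ms n} {A} →
      Derives T Θ Γ (jbase (jTy A)) → Derives T Θ Γ (jbase (jEqTy A A))
    eqTy-sym : ∀ {Γ : VCtx 𝕊 ms n} {A B} →
      Derives T Θ Γ (jbase (jEqTy A B)) → Derives T Θ Γ (jbase (jEqTy B A))
    eqTy-trans : ∀ {Γ : VCtx 𝕊 ms n} {A B C} →
      Derives T Θ Γ (jbase (jEqTy A B)) → Derives T Θ Γ (jbase (jEqTy B C)) →
      Derives T Θ Γ (jbase (jEqTy A C))
    eqTm-refl : ∀ {Γ : VCtx 𝕊 ms n} {t A} →
      Derives T Θ Γ (jbase (jTm t A)) → Derives T Θ Γ (jbase (jEqTm t t A))
    eqTm-sym : ∀ {Γ : VCtx 𝕊 ms n} {s t A} →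
      Derives T Θ Γ (jbase (jEqTm s t A)) → Derives T Θ Γ (jbase (jEqTm t s A))
    eqTm-trans : ∀ {Γ : VCtx 𝕊 ms n} {s t u A} →
      Derives T Θ Γ (jbase (jEqTm s t A)) → Derives T Θ Γ (jbase (jEqTm t u A)) →
      Derives T Θ Γ (jbase (jEqTm s u A))
    conv-tm : ∀ {Γ : VCtx 𝕊 ms n} {t A B} →
      Derives T Θ Γ (jbase (jTm t A)) → Derives T Θ Γ (jbase (jEqTy A B)) →
      Derives T Θ Γ (jbase (jTm t B))
    conv-eqTm : ∀ {Γ : VCtx 𝕊 ms n} {s t A B} →
      Derives T Θ Γ (jbase (jEqTm s t A)) → Derives T Θ Γ (jbase (jEqTy A B)) →
      Derives T Θ Γ (jbase (jEqTm s t B))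
    rule-inst : ∀ {Γ : VCtx 𝕊 ms n} (r : Rule T) (I : Inst 𝕊 (shape (rule T r)) ms n) →
      Prems T Θ Γ (prem (rule T r)) I →
      DerivesB T Θ Γ (bbase (I⋆BB I (bdry (rule T r)))) →
      Derives T Θ Γ (jbase (I⋆BJ I (fillB (bdry (rule T r)) (head (rule T r)))))
    rule-congr-ty : ∀ {Γ : VCtx 𝕊 ms n} (r : Rule T) {e : Expr 𝕊 (shape (rule T r)) 0 ty} →
      concl (rule T r) ≡ (obj ty , bTy , e) →
      (I J : Inst 𝕊 (shape (rule T r)) ms n) →
      Prems T Θ Γ (prem (rule T r)) I →
      Prems T Θ Γ (prem (rule T r)) J →
      EqPrems T Θ Γ (prem (rule T r)) I J →
      Derives T Θ Γ (jbase (jEqTy (I⋆ I e) (I⋆ J e)))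
    rule-congr-tm : ∀ {Γ : VCtx 𝕊 ms n} (r : Rule T) {e : Expr 𝕊 (shape (rule T r)) 0 tm}
      {A : Expr 𝕊 (shape (rule T r)) 0 ty} →
      concl (rule T r) ≡ (obj tm , bTm A , e) →
      (I J : Inst 𝕊 (shape (rule T r)) ms n) →
      Prems T Θ Γ (prem (rule T r)) I →
      Prems T Θ Γ (prem (rule T r)) J →
      EqPrems T Θ Γ (prem (rule T r)) I J →
      Derives T Θ Γ (jbase (jEqTy (I⋆ I A) (I⋆ J A))) →
      Derives T Θ Γ (jbase (jEqTm (I⋆ I e) (I⋆ J e) (I⋆ I A)))

  data DerivesB (T : RawTT 𝕊) (Θ : MCtx 𝕊 ms) : VCtx 𝕊 ms n → Bdry 𝕊 ms n (f , k) → Set where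
    bdry-ty : ∀ {Γ : VCtx 𝕊 ms n} → DerivesB T Θ Γ (bbase bTy)
    bdry-tm : ∀ {Γ : VCtx 𝕊 ms n} {A} →
      Derives T Θ Γ (jbase (jTy A)) → DerivesB T Θ Γ (bbase (bTm A))
    bdry-eqTy : ∀ {Γ : VCtx 𝕊 ms n} {A B} →
      Derives T Θ Γ (jbase (jTy A)) → Derives T Θ Γ (jbase (jTy B)) →
      DerivesB T Θ Γ (bbase (bEqTy A B))
    bdry-eqTm : ∀ {Γ : VCtx 𝕊 ms n} {s t A} →
      Derives T Θ Γ (jbase (jTy A)) → Derives T Θ Γ (jbase (jTm s A)) →
      Derives T Θ Γ (jbase (jTm t A)) →
      DerivesB T Θ Γ (bbase (bEqTm s t A))
    bdry-abs : ∀ {Γ : VCtx 𝕊 ms n} {A : Expr 𝕊 ms n ty} {B : Bdry 𝕊 ms (suc n) (f , k)} →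
      Derives T Θ Γ (jbase (jTy A)) → DerivesB T Θ (Γ ▷ᵛ A) B →
      DerivesB T Θ Γ (babs A B)

  data ArgSpine (T : RawTT 𝕊) (Θ : MCtx 𝕊 ms) (Γ : VCtx 𝕊 ms n) :
         Bdry 𝕊 ms j (f , k) → Sub 𝕊 ms j n → Vec (Expr 𝕊 ms n tm) k → Set where
    []  : ∀ {b : BBdry 𝕊 ms j f} {σ} → ArgSpine T Θ Γ (bbase b) σ []
    _∷_ : ∀ {A : Expr 𝕊 ms j ty} {B : Bdry 𝕊 ms (suc j) (f , k)} {σ t ts} →
      Derives T Θ Γ (jbase (jTm t (sub σ A))) →
      ArgSpine T Θ Γ B (t ▸ σ) ts →
      ArgSpine T Θ Γ (babs A B) σ (t ∷ ts)

  data EqSpine (T : RawTT 𝕊) (Θ : MCtx 𝕊 ms) (Γ : VCtx 𝕊 ms n) :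
         Bdry 𝕊 ms j (f , k) → Sub 𝕊 ms j n → Vec (Expr 𝕊 ms n tm) k → Vec (Expr 𝕊 ms n tm) k → Set where
    []  : ∀ {b : BBdry 𝕊 ms j f} {σ} → EqSpine T Θ Γ (bbase b) σ [] []
    _∷_ : ∀ {A : Expr 𝕊 ms j ty} {B : Bdry 𝕊 ms (suc j) (f , k)} {σ s t ss ts} →
      Derives T Θ Γ (jbase (jEqTm s t (sub σ A))) →
      EqSpine T Θ Γ B (s ▸ σ) ss ts →
      EqSpine T Θ Γ (babs A B) σ (s ∷ ss) (t ∷ ts)

  data Prems (T : RawTT 𝕊) (Θ : MCtx 𝕊 ms) (Γ : VCtx 𝕊 ms n) :
         MCtx 𝕊 sh → Inst 𝕊 sh ms n → Set where
    []  : Prems T Θ Γ ∅ᵐ []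
    _∷_ : ∀ {Θᴿ : MCtx 𝕊 sh} {I : Inst 𝕊 sh ms n} {B : Bdry 𝕊 sh 0 (f , k)}
            {e : Head 𝕊 ms (n ⊕ k) f} →
      Derives T Θ Γ (fill (I⋆B I B) e) →
      Prems T Θ Γ Θᴿ I →
      Prems T Θ Γ (Θᴿ ▷ᵐ B) (e ∷ I)

  data EqPrems (T : RawTT 𝕊) (Θ : MCtx 𝕊 ms) (Γ : VCtx 𝕊 ms n) :
         MCtx 𝕊 sh → Inst 𝕊 sh ms n → Inst 𝕊 sh ms n → Set where
    []     : EqPrems T Θ Γ ∅ᵐ [] []
    obj∷   : ∀ {Θᴿ : MCtx 𝕊 sh} {I J : Inst 𝕊 sh ms n} {B : Bdry 𝕊 sh 0 (obj c , k)}
               {e e' : Expr 𝕊 ms (n ⊕ k) c} →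
      Derives T Θ Γ (eqJ (I⋆B I B) e e') →
      EqPrems T Θ Γ Θᴿ I J →
      EqPrems T Θ Γ (Θᴿ ▷ᵐ B) (e ∷ I) (e' ∷ J)
    eq∷    : ∀ {Θᴿ : MCtx 𝕊 sh} {I J : Inst 𝕊 sh ms n} {B : Bdry 𝕊 sh 0 (eq c , k)} →
      EqPrems T Θ Γ Θᴿ I J →
      EqPrems T Θ Γ (Θᴿ ▷ᵐ B) (tt ∷ I) (tt ∷ J)

  mhead : (f , k) ∈ ms → Vec (Expr 𝕊 ms n tm) k → Head 𝕊 ms n f
  mhead {f = obj c} p ts = meta p ts
  mhead {f = eq c}  p ts = tt

data WFMCtx (T : RawTT 𝕊) : MCtx 𝕊 ms → Set where
  ∅ᵐ   : WFMCtx T ∅ᵐ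
  _▷ᵐ_ : ∀ {Θ : MCtx 𝕊 ms} {a} {B : Bdry 𝕊 ms 0 a} →
    WFMCtx T Θ → DerivesB T Θ ∅ᵛ B → WFMCtx T (Θ ▷ᵐ B)

data WFVCtx (T : RawTT 𝕊) (Θ : MCtx 𝕊 ms) : VCtx 𝕊 ms n → Set where
  ∅ᵛ   : WFVCtx T Θ ∅ᵛ
  _▷ᵛ_ : ∀ {Γ : VCtx 𝕊 ms n} {A} →
    WFVCtx T Θ Γ → Derives T Θ Γ (jbase (jTy A)) → WFVCtx T Θ (Γ ▷ᵛ A)

{-# OPTIONS --safe #-}

-- TT-Meta and rule instantiations carry the
-- boundary of their conclusion as a premise; for the other rules the boundary
-- is assembled from the boundaries of the premises, using conversion for the
-- right-hand side of congruence rules. The variable rule needs Γ(a) type,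
-- which well-formedness of Γ provides in a prefix of Γ, so derivations must be
-- weakened; weakening through rule instantiations rests on renaming commuting
-- with instantiation.

module Submission where

open import Defs
open import Data.Nat using (ℕ; zero; suc)
open import Data.List using (List)
open import Data.Product using (_,_)
open import Data.Fin using (Fin; zero; suc)
open import Data.Vec using (Vec; []; _∷_)
open import Data.Unit using (tt)
open import Data.List.Membership.Propositional using (_∈_)
open import Data.List.Relation.Unary.Any using (here; there)
open import Data.List.Relation.Unary.All using ([]; _∷_; lookup)
open import Function using (_∘_)
open import Relation.Binary.PropositionalEquality
  using (_≡_; refl; trans; cong; cong₂; subst; subst₂; _≗_; module ≡-Reasoning)
  renaming (sym to ≡-sym)

variable
  l n′ : ℕ

liftR-∘ : {π₁ : Ren m l} {π₂ : Ren n m} {π₃ : Ren n l} →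
  π₁ ∘ π₂ ≗ π₃ → liftR π₁ ∘ liftR π₂ ≗ liftR π₃
liftR-∘ h zero    = refl
liftR-∘ h (suc i) = cong suc (h i)

liftR⊕-∘ : ∀ k {π₁ : Ren m l} {π₂ : Ren n m} {π₃ : Ren n l} →
  π₁ ∘ π₂ ≗ π₃ → liftR⊕ k π₁ ∘ liftR⊕ k π₂ ≗ liftR⊕ k π₃
liftR⊕-∘ zero    h = h
liftR⊕-∘ (suc k) h = liftR⊕-∘ k (liftR-∘ h)

mutual
  ren-∘ : {π₁ : Ren m l} {π₂ : Ren n m} {π₃ : Ren n l} → π₁ ∘ π₂ ≗ π₃ →
    (e : Expr 𝕊 ms n c) → ren π₁ (ren π₂ e) ≡ ren π₃ e
  ren-∘ h (var i)     = cong var (h i)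
  ren-∘ h (sym s es)  = cong (sym s) (renArgs-∘ h es)
  ren-∘ h (meta p ts) = cong (meta p) (renVec-∘ h ts)

  renArgs-∘ : ∀ {as} {π₁ : Ren m l} {π₂ : Ren n m} {π₃ : Ren n l} → π₁ ∘ π₂ ≗ π₃ →
    (es : Args 𝕊 ms n as) → renArgs π₁ (renArgs π₂ es) ≡ renArgs π₃ es
  renArgs-∘ h []                 = refl
  renArgs-∘ h (_∷_ {k = k} e es) = cong₂ _∷_ (ren-∘ (liftR⊕-∘ k h) e) (renArgs-∘ h es)

  renVec-∘ : {π₁ : Ren m l} {π₂ : Ren n m} {π₃ : Ren n l} → π₁ ∘ π₂ ≗ π₃ →
    (ts : Vec (Expr 𝕊 ms n tm) k) → renVec π₁ (renVec π₂ ts) ≡ renVec π₃ ts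
  renVec-∘ h []       = refl
  renVec-∘ h (t ∷ ts) = cong₂ _∷_ (ren-∘ h t) (renVec-∘ h ts)

liftR⊕-wk⊕ : ∀ k (π : Ren m l) → liftR⊕ k π ∘ wk⊕ k ≗ wk⊕ k ∘ π
liftR⊕-wk⊕ zero    π i = refl
liftR⊕-wk⊕ (suc k) π i = liftR⊕-wk⊕ k (liftR π) (suc i)

ren-liftR⊕-wk⊕ : ∀ k (π : Ren n m) (e : Expr 𝕊 ms n c) →
  ren (liftR⊕ k π) (ren (wk⊕ k) e) ≡ ren (wk⊕ k) (ren π e)
ren-liftR⊕-wk⊕ k π e =
  trans (ren-∘ (liftR⊕-wk⊕ k π) e) (≡-sym (ren-∘ (λ _ → refl) e))

ren-liftS : {π : Ren m l} {σ : Sub 𝕊 ms n m} {σ′ : Sub 𝕊 ms n l} →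
  ren π ∘ σ ≗ σ′ → ren (liftR π) ∘ liftS σ ≗ liftS σ′
ren-liftS h zero = refl
ren-liftS {π = π} {σ} h (suc i) =
  trans (ren-liftR⊕-wk⊕ 1 π (σ i)) (cong (ren suc) (h i))

ren-liftS⊕ : ∀ k {π : Ren m l} {σ : Sub 𝕊 ms n m} {σ′ : Sub 𝕊 ms n l} →
  ren π ∘ σ ≗ σ′ → ren (liftR⊕ k π) ∘ liftS⊕ k σ ≗ liftS⊕ k σ′
ren-liftS⊕ zero    h = h
ren-liftS⊕ (suc k) h = ren-liftS⊕ k (ren-liftS h)

mutual
  ren-sub : {π : Ren m l} {σ : Sub 𝕊 ms n m} {σ′ : Sub 𝕊 ms n l} → ren π ∘ σ ≗ σ′ →
    (e : Expr 𝕊 ms n c) → ren π (sub σ e) ≡ sub σ′ e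
  ren-sub h (var i)     = h i
  ren-sub h (sym s es)  = cong (sym s) (renArgs-subArgs h es)
  ren-sub h (meta p ts) = cong (meta p) (renVec-subVec h ts)

  renArgs-subArgs : ∀ {as} {π : Ren m l} {σ : Sub 𝕊 ms n m} {σ′ : Sub 𝕊 ms n l} →
    ren π ∘ σ ≗ σ′ → (es : Args 𝕊 ms n as) → renArgs π (subArgs σ es) ≡ subArgs σ′ es
  renArgs-subArgs h []                 = refl
  renArgs-subArgs h (_∷_ {k = k} e es) =
    cong₂ _∷_ (ren-sub (ren-liftS⊕ k h) e) (renArgs-subArgs h es)

  renVec-subVec : {π : Ren m l} {σ : Sub 𝕊 ms n m} {σ′ : Sub 𝕊 ms n l} →
    ren π ∘ σ ≗ σ′ → (ts : Vec (Expr 𝕊 ms n tm) k) → renVec π (subVec σ ts) ≡ subVec σ′ ts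
  renVec-subVec h []       = refl
  renVec-subVec h (t ∷ ts) = cong₂ _∷_ (ren-sub h t) (renVec-subVec h ts)

liftS-liftR : {τ : Ren n m} {σ : Sub 𝕊 ms m l} {σ′ : Sub 𝕊 ms n l} →
  σ ∘ τ ≗ σ′ → liftS σ ∘ liftR τ ≗ liftS σ′
liftS-liftR h zero    = refl
liftS-liftR h (suc i) = cong (ren suc) (h i)

liftS⊕-liftR⊕ : ∀ k {τ : Ren n m} {σ : Sub 𝕊 ms m l} {σ′ : Sub 𝕊 ms n l} →
  σ ∘ τ ≗ σ′ → liftS⊕ k σ ∘ liftR⊕ k τ ≗ liftS⊕ k σ′
liftS⊕-liftR⊕ zero    h = h
liftS⊕-liftR⊕ (suc k) h = liftS⊕-liftR⊕ k (liftS-liftR h)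

mutual
  sub-ren : {τ : Ren n m} {σ : Sub 𝕊 ms m l} {σ′ : Sub 𝕊 ms n l} → σ ∘ τ ≗ σ′ →
    (e : Expr 𝕊 ms n c) → sub σ (ren τ e) ≡ sub σ′ e
  sub-ren h (var i)     = h i
  sub-ren h (sym s es)  = cong (sym s) (subArgs-renArgs h es)
  sub-ren h (meta p ts) = cong (meta p) (subVec-renVec h ts)

  subArgs-renArgs : ∀ {as} {τ : Ren n m} {σ : Sub 𝕊 ms m l} {σ′ : Sub 𝕊 ms n l} →
    σ ∘ τ ≗ σ′ → (es : Args 𝕊 ms n as) → subArgs σ (renArgs τ es) ≡ subArgs σ′ es
  subArgs-renArgs h []                 = refl
  subArgs-renArgs h (_∷_ {k = k} e es) =
    cong₂ _∷_ (sub-ren (liftS⊕-liftR⊕ k h) e) (subArgs-renArgs h es)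

  subVec-renVec : {τ : Ren n m} {σ : Sub 𝕊 ms m l} {σ′ : Sub 𝕊 ms n l} →
    σ ∘ τ ≗ σ′ → (ts : Vec (Expr 𝕊 ms n tm) k) → subVec σ (renVec τ ts) ≡ subVec σ′ ts
  subVec-renVec h []       = refl
  subVec-renVec h (t ∷ ts) = cong₂ _∷_ (sub-ren h t) (subVec-renVec h ts)

renH : Ren n m → Head 𝕊 ms n f → Head 𝕊 ms m f
renH {f = obj c} π e = ren π e
renH {f = eq c}  π _ = tt

renInst : Ren n m → Inst 𝕊 sh ms n → Inst 𝕊 sh ms m
renInst π []                    = []
renInst π (_∷_ {x = _ , k} e I) = renH (liftR⊕ k π) e ∷ renInst π I

lookup-renInst : (π : Ren n m) (I : Inst 𝕊 sh ms n) (p : (obj c , k) ∈ sh) →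
  lookup (renInst π I) p ≡ ren (liftR⊕ k π) (lookup I p)
lookup-renInst π (e ∷ I) (here refl) = refl
lookup-renInst π (e ∷ I) (there p)   = lookup-renInst π I p

ren-▸ : {π : Ren m l} {σ : Sub 𝕊 ms n m} {σ′ : Sub 𝕊 ms n l} → ren π ∘ σ ≗ σ′ →
  (t : Expr 𝕊 ms m tm) → ren π ∘ (t ▸ σ) ≗ (ren π t ▸ σ′)
ren-▸ h t zero    = refl
ren-▸ h t (suc i) = h i

ren-extend⋆ : {π : Ren m l} {σ : Sub 𝕊 ms n m} {σ′ : Sub 𝕊 ms n l} → ren π ∘ σ ≗ σ′ →
  (ts : Vec (Expr 𝕊 ms m tm) k) → ren π ∘ extend⋆ σ ts ≗ extend⋆ σ′ (renVec π ts)
ren-extend⋆ h []       = h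
ren-extend⋆ h (t ∷ ts) = ren-extend⋆ (ren-▸ h t) ts

ren-extend⋆-liftR⊕ : {π : Ren m l} {τ : Ren n n′} {ρ : Sub 𝕊 ms n m} {ρ′ : Sub 𝕊 ms n′ l} →
  ren π ∘ ρ ≗ ρ′ ∘ τ → (ts : Vec (Expr 𝕊 ms m tm) k) →
  ren π ∘ extend⋆ ρ ts ≗ extend⋆ ρ′ (renVec π ts) ∘ liftR⊕ k τ
ren-extend⋆-liftR⊕ h []       = h
ren-extend⋆-liftR⊕ h (t ∷ ts) = ren-extend⋆-liftR⊕ h′ ts
  where
  h′ : ren _ ∘ (t ▸ _) ≗ (ren _ t ▸ _) ∘ liftR _
  h′ zero    = refl
  h′ (suc i) = h i

ren-wkS : ∀ k {π : Ren m l} {τ : Ren n n′} {ρ : Sub 𝕊 ms n m} {ρ′ : Sub 𝕊 ms n′ l} →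
  ren π ∘ ρ ≗ ρ′ ∘ τ → ren (liftR⊕ k π) ∘ wkS k ρ ≗ wkS k ρ′ ∘ τ
ren-wkS k {π} {ρ = ρ} h i = trans (ren-liftR⊕-wk⊕ k π (ρ i)) (cong (ren (wk⊕ k)) (h i))

-- ρ interprets the free variables of I, so renaming commutes with
-- instantiation only once I itself is renamed (by τ) to match ρ′.
mutual
  ren-instE : {I : Inst 𝕊 sh ms n} {π : Ren m l} {τ : Ren n n′}
    {ρ : Sub 𝕊 ms n m} {ρ′ : Sub 𝕊 ms n′ l} {σ : Sub 𝕊 ms j m} {σ′ : Sub 𝕊 ms j l} →
    ren π ∘ ρ ≗ ρ′ ∘ τ → ren π ∘ σ ≗ σ′ →
    (e : Expr 𝕊 sh j c) → ren π (instE I ρ σ e) ≡ instE (renInst τ I) ρ′ σ′ e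
  ren-instE hρ hσ (var i)    = hσ i
  ren-instE hρ hσ (sym s es) = cong (sym s) (renArgs-instArgs hρ hσ es)
  ren-instE {I = I} {π} {τ} {ρ} {ρ′} {σ} {σ′} hρ hσ (meta {k = k} p ts) = begin
    ren π (sub (extend⋆ ρ (instVec I ρ σ ts)) (lookup I p))
      ≡⟨ ren-sub (ren-extend⋆-liftR⊕ hρ (instVec I ρ σ ts)) (lookup I p) ⟩
    sub (extend⋆ ρ′ (renVec π (instVec I ρ σ ts)) ∘ liftR⊕ k τ) (lookup I p)
      ≡⟨ cong (λ us → sub (extend⋆ ρ′ us ∘ liftR⊕ k τ) (lookup I p))
              (renVec-instVec hρ hσ ts) ⟩
    sub (extend⋆ ρ′ ts′ ∘ liftR⊕ k τ) (lookup I p)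
      ≡⟨ sub-ren (λ _ → refl) (lookup I p) ⟨
    sub (extend⋆ ρ′ ts′) (ren (liftR⊕ k τ) (lookup I p))
      ≡⟨ cong (sub (extend⋆ ρ′ ts′)) (lookup-renInst τ I p) ⟨
    sub (extend⋆ ρ′ ts′) (lookup (renInst τ I) p)
      ∎
    where
    open ≡-Reasoning
    ts′ = instVec (renInst τ I) ρ′ σ′ ts

  renArgs-instArgs : ∀ {as} {I : Inst 𝕊 sh ms n} {π : Ren m l} {τ : Ren n n′}
    {ρ : Sub 𝕊 ms n m} {ρ′ : Sub 𝕊 ms n′ l} {σ : Sub 𝕊 ms j m} {σ′ : Sub 𝕊 ms j l} →
    ren π ∘ ρ ≗ ρ′ ∘ τ → ren π ∘ σ ≗ σ′ →
    (es : Args 𝕊 sh j as) → renArgs π (instArgs I ρ σ es) ≡ instArgs (renInst τ I) ρ′ σ′ es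
  renArgs-instArgs hρ hσ []                 = refl
  renArgs-instArgs {τ = τ} {ρ′ = ρ′} hρ hσ (_∷_ {k = k} e es) =
    cong₂ _∷_ (ren-instE (ren-wkS k {τ = τ} {ρ′ = ρ′} hρ) (ren-liftS⊕ k hσ) e)
              (renArgs-instArgs hρ hσ es)

  renVec-instVec : {I : Inst 𝕊 sh ms n} {π : Ren m l} {τ : Ren n n′}
    {ρ : Sub 𝕊 ms n m} {ρ′ : Sub 𝕊 ms n′ l} {σ : Sub 𝕊 ms j m} {σ′ : Sub 𝕊 ms j l} →
    ren π ∘ ρ ≗ ρ′ ∘ τ → ren π ∘ σ ≗ σ′ →
    (ts : Vec (Expr 𝕊 sh j tm) k) → renVec π (instVec I ρ σ ts) ≡ instVec (renInst τ I) ρ′ σ′ ts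
  renVec-instVec hρ hσ []       = refl
  renVec-instVec hρ hσ (t ∷ ts) = cong₂ _∷_ (ren-instE hρ hσ t) (renVec-instVec hρ hσ ts)

renBB : Ren n m → BBdry 𝕊 ms n f → BBdry 𝕊 ms m f
renBB π bTy           = bTy
renBB π (bTm A)       = bTm (ren π A)
renBB π (bEqTy A B)   = bEqTy (ren π A) (ren π B)
renBB π (bEqTm s t A) = bEqTm (ren π s) (ren π t) (ren π A)

renB : ∀ {a} → Ren n m → Bdry 𝕊 ms n a → Bdry 𝕊 ms m a
renB π (bbase b)  = bbase (renBB π b)
renB π (babs A B) = babs (ren π A) (renB (liftR π) B)

renBJ : Ren n m → BJdg 𝕊 ms n f → BJdg 𝕊 ms m f
renBJ π (jTy A)       = jTy (ren π A)
renBJ π (jTm t A)     = jTm (ren π t) (ren π A)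
renBJ π (jEqTy A B)   = jEqTy (ren π A) (ren π B)
renBJ π (jEqTm s t A) = jEqTm (ren π s) (ren π t) (ren π A)

renJ : ∀ {a} → Ren n m → Jdg 𝕊 ms n a → Jdg 𝕊 ms m a
renJ π (jbase b)  = jbase (renBJ π b)
renJ π (jabs A J) = jabs (ren π A) (renJ (liftR π) J)

renBJ-fillB : (π : Ren n m) (X : BBdry 𝕊 ms n f) (e : Head 𝕊 ms n f) →
  renBJ π (fillB X e) ≡ fillB (renBB π X) (renH π e)
renBJ-fillB π bTy           e = refl
renBJ-fillB π (bTm A)       e = refl
renBJ-fillB π (bEqTy A B)   e = refl
renBJ-fillB π (bEqTm s t A) e = refl

renJ-fill : (π : Ren n m) (X : Bdry 𝕊 ms n (f , k)) (e : Head 𝕊 ms (n ⊕ k) f) →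
  renJ π (fill X e) ≡ fill (renB π X) (renH (liftR⊕ k π) e)
renJ-fill π (bbase b)  e = cong jbase (renBJ-fillB π b e)
renJ-fill π (babs A B) e = cong (jabs (ren π A)) (renJ-fill (liftR π) B e)

renJ-eqJ : (π : Ren n m) (X : Bdry 𝕊 ms n (obj c , k)) (e e′ : Expr 𝕊 ms (n ⊕ k) c) →
  renJ π (eqJ X e e′) ≡ eqJ (renB π X) (ren (liftR⊕ k π) e) (ren (liftR⊕ k π) e′)
renJ-eqJ π (bbase bTy)     e e′ = refl
renJ-eqJ π (bbase (bTm A)) e e′ = refl
renJ-eqJ π (babs A B)      e e′ = cong (jabs (ren π A)) (renJ-eqJ (liftR π) B e e′)

renH-mhead : (π : Ren n m) (p : (f , k) ∈ ms) (ts : Vec (Expr 𝕊 ms n tm) k) →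
  renH π (mhead p ts) ≡ mhead p (renVec π ts)
renH-mhead {f = obj c} π p ts = refl
renH-mhead {f = eq c}  π p ts = refl

renBB-subBB : {π : Ren m l} {σ : Sub 𝕊 ms n m} {σ′ : Sub 𝕊 ms n l} →
  ren π ∘ σ ≗ σ′ → (X : BBdry 𝕊 ms n f) → renBB π (subBB σ X) ≡ subBB σ′ X
renBB-subBB h bTy           = refl
renBB-subBB h (bTm A)       rewrite ren-sub h A = refl
renBB-subBB h (bEqTy A B)   rewrite ren-sub h A | ren-sub h B = refl
renBB-subBB h (bEqTm s t A) rewrite ren-sub h s | ren-sub h t | ren-sub h A = refl

module _ {I : Inst 𝕊 sh ms n} {I′ : Inst 𝕊 sh ms n′} {π : Ren m l}
         {ρ : Sub 𝕊 ms n m} {ρ′ : Sub 𝕊 ms n′ l} {σ : Sub 𝕊 ms j m} {σ′ : Sub 𝕊 ms j l}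
         (h : ∀ {c} (e : Expr 𝕊 sh j c) → ren π (instE I ρ σ e) ≡ instE I′ ρ′ σ′ e) where

  renBB-instBB : (X : BBdry 𝕊 sh j f) → renBB π (instBB I ρ σ X) ≡ instBB I′ ρ′ σ′ X
  renBB-instBB bTy           = refl
  renBB-instBB (bTm A)       rewrite h A = refl
  renBB-instBB (bEqTy A B)   rewrite h A | h B = refl
  renBB-instBB (bEqTm s t A) rewrite h s | h t | h A = refl

  renBJ-instBJ : (X : BJdg 𝕊 sh j f) → renBJ π (instBJ I ρ σ X) ≡ instBJ I′ ρ′ σ′ X
  renBJ-instBJ (jTy A)       rewrite h A = refl
  renBJ-instBJ (jTm t A)     rewrite h t | h A = refl
  renBJ-instBJ (jEqTy A B)   rewrite h A | h B = refl
  renBJ-instBJ (jEqTm s t A) rewrite h s | h t | h A = refl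

renB-instB : ∀ {a} {I : Inst 𝕊 sh ms n} {π : Ren m l} {τ : Ren n n′}
  {ρ : Sub 𝕊 ms n m} {ρ′ : Sub 𝕊 ms n′ l} {σ : Sub 𝕊 ms j m} {σ′ : Sub 𝕊 ms j l} →
  ren π ∘ ρ ≗ ρ′ ∘ τ → ren π ∘ σ ≗ σ′ →
  (X : Bdry 𝕊 sh j a) → renB π (instB I ρ σ X) ≡ instB (renInst τ I) ρ′ σ′ X
renB-instB hρ hσ (bbase b)  = cong bbase (renBB-instBB (ren-instE hρ hσ) b)
renB-instB {τ = τ} {ρ′ = ρ′} hρ hσ (babs A B) =
  cong₂ babs (ren-instE hρ hσ A) (renB-instB (ren-wkS 1 {τ = τ} {ρ′ = ρ′} hρ) (ren-liftS hσ) B)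

ren-I⋆ : (I : Inst 𝕊 sh ms n) (π : Ren n m) (e : Expr 𝕊 sh 0 c) →
  ren π (I⋆ I e) ≡ I⋆ (renInst π I) e
ren-I⋆ I π = ren-instE {τ = π} {ρ′ = var} (λ _ → refl) (λ ())

renB-I⋆B : ∀ {a} (I : Inst 𝕊 sh ms n) (π : Ren n m) (X : Bdry 𝕊 sh 0 a) →
  renB π (I⋆B I X) ≡ I⋆B (renInst π I) X
renB-I⋆B I π = renB-instB {τ = π} {ρ′ = var} (λ _ → refl) (λ ())

ren-sub-extend⋆ : (π : Ren n m) (ts : Vec (Expr 𝕊 ms n tm) k) (A : Expr 𝕊 ms (0 ⊕ k) c) →
  ren π (sub (extend⋆ emptyS ts) A) ≡ sub (extend⋆ emptyS (renVec π ts)) A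
ren-sub-extend⋆ π ts = ren-sub (ren-extend⋆ (λ ()) ts)

renBB-subBB-extend⋆ : (π : Ren n m) (ts : Vec (Expr 𝕊 ms n tm) k) (X : BBdry 𝕊 ms (0 ⊕ k) f) →
  renBB π (subBB (extend⋆ emptyS ts) X) ≡ subBB (extend⋆ emptyS (renVec π ts)) X
renBB-subBB-extend⋆ π ts = renBB-subBB (ren-extend⋆ (λ ()) ts)

renJ-fill-I⋆B : (I : Inst 𝕊 sh ms n) (π : Ren n m) (B : Bdry 𝕊 sh 0 (f , k))
  (e : Head 𝕊 ms (n ⊕ k) f) →
  renJ π (fill (I⋆B I B) e) ≡ fill (I⋆B (renInst π I) B) (renH (liftR⊕ k π) e)
renJ-fill-I⋆B I π B e =
  trans (renJ-fill π (I⋆B I B) e) (cong (λ X → fill X _) (renB-I⋆B I π B))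

renJ-eqJ-I⋆B : (I : Inst 𝕊 sh ms n) (π : Ren n m) (B : Bdry 𝕊 sh 0 (obj c , k))
  (e e′ : Expr 𝕊 ms (n ⊕ k) c) →
  renJ π (eqJ (I⋆B I B) e e′)
    ≡ eqJ (I⋆B (renInst π I) B) (ren (liftR⊕ k π) e) (ren (liftR⊕ k π) e′)
renJ-eqJ-I⋆B I π B e e′ =
  trans (renJ-eqJ π (I⋆B I B) e e′) (cong (λ X → eqJ X _ _) (renB-I⋆B I π B))

VCtxRen : Ren n m → VCtx 𝕊 ms n → VCtx 𝕊 ms m → Set
VCtxRen {n = n} π Γ Δ = (i : Fin n) → lookupV Δ (π i) ≡ ren π (lookupV Γ i)

liftR-VCtxRen : {π : Ren n m} {Γ : VCtx 𝕊 ms n} {Δ : VCtx 𝕊 ms m} → VCtxRen π Γ Δ →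
  (A : Expr 𝕊 ms n ty) → VCtxRen (liftR π) (Γ ▷ᵛ A) (Δ ▷ᵛ ren π A)
liftR-VCtxRen {π = π} h A zero = ≡-sym (ren-liftR⊕-wk⊕ 1 π A)
liftR-VCtxRen {π = π} {Γ} h A (suc i) =
  trans (cong (ren suc) (h i)) (≡-sym (ren-liftR⊕-wk⊕ 1 π (lookupV Γ i)))

module _ {T : RawTT 𝕊} {Θ : MCtx 𝕊 ms} where
  mutual
    renDerives : {Γ : VCtx 𝕊 ms n} {Δ : VCtx 𝕊 ms m} {J : Jdg 𝕊 ms n (f , k)} (π : Ren n m) →
      VCtxRen π Γ Δ → Derives T Θ Γ J → Derives T Θ Δ (renJ π J)
    renDerives {Δ = Δ} π h (var-rule i) =
      subst (λ A → Derives T Θ Δ (jbase (jTm (var (π i)) A))) (h i) (var-rule (π i))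
    renDerives {Δ = Δ} π h (meta-rule p ts a b) =
      subst (λ J → Derives T Θ Δ (jbase J)) (≡-sym conclusion)
        (meta-rule p (renVec π ts) (renArgSpine π h a (λ ()))
          (subst (λ X → DerivesB T Θ Δ (bbase X)) (renBB-subBB-extend⋆ π ts X)
            (renDerivesB π h b)))
      where
      X = body (lookupM Θ p)
      conclusion : renBJ π (fillB (subBB (extend⋆ emptyS ts) X) (mhead p ts))
                 ≡ fillB (subBB (extend⋆ emptyS (renVec π ts)) X) (mhead p (renVec π ts))
      conclusion = trans (renBJ-fillB π _ (mhead p ts))
                         (cong₂ fillB (renBB-subBB-extend⋆ π ts X) (renH-mhead π p ts))
    renDerives π h (meta-congr-ty p ss ts as at es) =
      meta-congr-ty p (renVec π ss) (renVec π ts)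
        (renArgSpine π h as (λ ())) (renArgSpine π h at (λ ())) (renEqSpine π h es (λ ()))
    renDerives {Δ = Δ} π h (meta-congr-tm p ss ts as at es d) =
      subst (λ A → Derives T Θ Δ (jbase (jEqTm (meta p (renVec π ss)) (meta p (renVec π ts)) A)))
        (≡-sym (ren-sub-extend⋆ π ss C))
        (meta-congr-tm p (renVec π ss) (renVec π ts)
          (renArgSpine π h as (λ ())) (renArgSpine π h at (λ ())) (renEqSpine π h es (λ ()))
          (subst₂ (λ A B → Derives T Θ Δ (jbase (jEqTy A B)))
            (ren-sub-extend⋆ π ss C) (ren-sub-extend⋆ π ts C) (renDerives π h d)))
      where
      C = tyOf (body (lookupM Θ p))
    renDerives π h (abstr {A = A} d e) =
      abstr (renDerives π h d) (renDerives (liftR π) (liftR-VCtxRen h A) e)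
    renDerives π h (eqTy-refl d)    = eqTy-refl (renDerives π h d)
    renDerives π h (eqTy-sym d)     = eqTy-sym (renDerives π h d)
    renDerives π h (eqTy-trans d e) = eqTy-trans (renDerives π h d) (renDerives π h e)
    renDerives π h (eqTm-refl d)    = eqTm-refl (renDerives π h d)
    renDerives π h (eqTm-sym d)     = eqTm-sym (renDerives π h d)
    renDerives π h (eqTm-trans d e) = eqTm-trans (renDerives π h d) (renDerives π h e)
    renDerives π h (conv-tm d e)    = conv-tm (renDerives π h d) (renDerives π h e)
    renDerives π h (conv-eqTm d e)  = conv-eqTm (renDerives π h d) (renDerives π h e)
    renDerives {Δ = Δ} π h (rule-inst r I ps b)
      rewrite renBJ-instBJ (ren-I⋆ I π) (fillB (bdry (rule T r)) (head (rule T r))) =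
      rule-inst r (renInst π I) (renPrems π h ps)
        (subst (λ X → DerivesB T Θ Δ (bbase X)) (renBB-instBB (ren-I⋆ I π) (bdry (rule T r)))
          (renDerivesB π h b))
    renDerives π h (rule-congr-ty r {e} cq I J ps qs es)
      rewrite ren-I⋆ I π e | ren-I⋆ J π e =
      rule-congr-ty r cq (renInst π I) (renInst π J)
        (renPrems π h ps) (renPrems π h qs) (renEqPrems π h es)
    renDerives {Δ = Δ} π h (rule-congr-tm r {e} {A} cq I J ps qs es d)
      rewrite ren-I⋆ I π e | ren-I⋆ J π e | ren-I⋆ I π A =
      rule-congr-tm r cq (renInst π I) (renInst π J)
        (renPrems π h ps) (renPrems π h qs) (renEqPrems π h es)
        (subst₂ (λ A B → Derives T Θ Δ (jbase (jEqTy A B)))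
          (ren-I⋆ I π A) (ren-I⋆ J π A) (renDerives π h d))

    renDerivesB : {Γ : VCtx 𝕊 ms n} {Δ : VCtx 𝕊 ms m} {B : Bdry 𝕊 ms n (f , k)} (π : Ren n m) →
      VCtxRen π Γ Δ → DerivesB T Θ Γ B → DerivesB T Θ Δ (renB π B)
    renDerivesB π h bdry-ty                = bdry-ty
    renDerivesB π h (bdry-tm d)            = bdry-tm (renDerives π h d)
    renDerivesB π h (bdry-eqTy d e)        = bdry-eqTy (renDerives π h d) (renDerives π h e)
    renDerivesB π h (bdry-eqTm d e g)      =
      bdry-eqTm (renDerives π h d) (renDerives π h e) (renDerives π h g)
    renDerivesB π h (bdry-abs {A = A} d b) =
      bdry-abs (renDerives π h d) (renDerivesB (liftR π) (liftR-VCtxRen h A) b)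

    renArgSpine : {Γ : VCtx 𝕊 ms n} {Δ : VCtx 𝕊 ms m} {B : Bdry 𝕊 ms j (f , k)} {σ : Sub 𝕊 ms j n}
      {σ′ : Sub 𝕊 ms j m} {ts : Vec (Expr 𝕊 ms n tm) k} (π : Ren n m) → VCtxRen π Γ Δ →
      ArgSpine T Θ Γ B σ ts → ren π ∘ σ ≗ σ′ → ArgSpine T Θ Δ B σ′ (renVec π ts)
    renArgSpine π h [] hσ = []
    renArgSpine {Δ = Δ} π h (_∷_ {A = A} {t = t} d a) hσ =
      subst (λ B → Derives T Θ Δ (jbase (jTm (ren π t) B))) (ren-sub hσ A) (renDerives π h d)
      ∷ renArgSpine π h a (ren-▸ hσ t)

    renEqSpine : {Γ : VCtx 𝕊 ms n} {Δ : VCtx 𝕊 ms m} {B : Bdry 𝕊 ms j (f , k)} {σ : Sub 𝕊 ms j n}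
      {σ′ : Sub 𝕊 ms j m} {ss ts : Vec (Expr 𝕊 ms n tm) k} (π : Ren n m) → VCtxRen π Γ Δ →
      EqSpine T Θ Γ B σ ss ts → ren π ∘ σ ≗ σ′ → EqSpine T Θ Δ B σ′ (renVec π ss) (renVec π ts)
    renEqSpine π h [] hσ = []
    renEqSpine {Δ = Δ} π h (_∷_ {A = A} {s = s} {t = t} d e) hσ =
      subst (λ B → Derives T Θ Δ (jbase (jEqTm (ren π s) (ren π t) B))) (ren-sub hσ A)
        (renDerives π h d)
      ∷ renEqSpine π h e (ren-▸ hσ s)

    renPrems : {Γ : VCtx 𝕊 ms n} {Δ : VCtx 𝕊 ms m} {Θᴿ : MCtx 𝕊 sh} {I : Inst 𝕊 sh ms n}
      (π : Ren n m) →
      VCtxRen π Γ Δ → Prems T Θ Γ Θᴿ I → Prems T Θ Δ Θᴿ (renInst π I)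
    renPrems π h [] = []
    renPrems {Δ = Δ} π h (_∷_ {I = I} {B = B} {e = e} d ps) =
      subst (Derives T Θ Δ) (renJ-fill-I⋆B I π B e) (renDerives π h d) ∷ renPrems π h ps

    renEqPrems : {Γ : VCtx 𝕊 ms n} {Δ : VCtx 𝕊 ms m} {Θᴿ : MCtx 𝕊 sh} {I J : Inst 𝕊 sh ms n}
      (π : Ren n m) →
      VCtxRen π Γ Δ → EqPrems T Θ Γ Θᴿ I J → EqPrems T Θ Δ Θᴿ (renInst π I) (renInst π J)
    renEqPrems π h [] = []
    renEqPrems {Δ = Δ} π h (obj∷ {I = I} {B = B} d es) =
      obj∷ (subst (Derives T Θ Δ) (renJ-eqJ-I⋆B I π B _ _) (renDerives π h d)) (renEqPrems π h es)
    renEqPrems π h (eq∷ es) = eq∷ (renEqPrems π h es)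

bdryBJ : BJdg 𝕊 ms n f → BBdry 𝕊 ms n f
bdryBJ (jTy A)       = bTy
bdryBJ (jTm t A)     = bTm A
bdryBJ (jEqTy A B)   = bEqTy A B
bdryBJ (jEqTm s t A) = bEqTm s t A

bdryJ : ∀ {a} → Jdg 𝕊 ms n a → Bdry 𝕊 ms n a
bdryJ (jbase b)  = bbase (bdryBJ b)
bdryJ (jabs A J) = babs A (bdryJ J)

bdryBJ-fillB : (X : BBdry 𝕊 ms n f) (e : Head 𝕊 ms n f) → bdryBJ (fillB X e) ≡ X
bdryBJ-fillB bTy           e = refl
bdryBJ-fillB (bTm A)       e = refl
bdryBJ-fillB (bEqTy A B)   e = refl
bdryBJ-fillB (bEqTm s t A) e = refl

bdryJ-fill : (X : Bdry 𝕊 ms n (f , k)) (e : Head 𝕊 ms (n ⊕ k) f) → bdryJ (fill X e) ≡ X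
bdryJ-fill (bbase b)  e = cong bbase (bdryBJ-fillB b e)
bdryJ-fill (babs A B) e = cong (babs A) (bdryJ-fill B e)

bdryBJ-I⋆BJ : (I : Inst 𝕊 sh ms n) (X : BBdry 𝕊 sh 0 f) (e : Head 𝕊 sh 0 f) →
  bdryBJ (I⋆BJ I (fillB X e)) ≡ I⋆BB I X
bdryBJ-I⋆BJ I bTy           e = refl
bdryBJ-I⋆BJ I (bTm A)       e = refl
bdryBJ-I⋆BJ I (bEqTy A B)   e = refl
bdryBJ-I⋆BJ I (bEqTm s t A) e = refl

module _ {T : RawTT 𝕊} {Θ : MCtx 𝕊 ms} where

  var-ty : {Γ : VCtx 𝕊 ms n} → WFVCtx T Θ Γ → (i : Fin n) →
    Derives T Θ Γ (jbase (jTy (lookupV Γ i)))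
  var-ty (w ▷ᵛ d) zero    = renDerives suc (λ _ → refl) d
  var-ty (w ▷ᵛ d) (suc i) = renDerives suc (λ _ → refl) (var-ty w i)

  meta-ty : {Γ : VCtx 𝕊 ms n} (p : (obj ty , k) ∈ ms) (ts : Vec (Expr 𝕊 ms n tm) k) →
    ArgSpine T Θ Γ (lookupM Θ p) emptyS ts → Derives T Θ Γ (jbase (jTy (meta p ts)))
  meta-ty p ts a with body (lookupM Θ p) | meta-rule p ts a
  ... | bTy | d = d bdry-ty

  meta-tm : {Γ : VCtx 𝕊 ms n} (p : (obj tm , k) ∈ ms) (ts : Vec (Expr 𝕊 ms n tm) k) →
    ArgSpine T Θ Γ (lookupM Θ p) emptyS ts →
    Derives T Θ Γ (jbase (jTy (sub (extend⋆ emptyS ts) (tyOf (body (lookupM Θ p)))))) →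
    Derives T Θ Γ (jbase (jTm (meta p ts) (sub (extend⋆ emptyS ts) (tyOf (body (lookupM Θ p))))))
  meta-tm p ts a with body (lookupM Θ p) | meta-rule p ts a
  ... | bTm C | d = d ∘ bdry-tm

  rule-inst-ty : {Γ : VCtx 𝕊 ms n} (r : Rule T) {e : Expr 𝕊 (shape (rule T r)) 0 ty} →
    concl (rule T r) ≡ (obj ty , bTy , e) → (I : Inst 𝕊 (shape (rule T r)) ms n) →
    Prems T Θ Γ (prem (rule T r)) I → Derives T Θ Γ (jbase (jTy (I⋆ I e)))
  rule-inst-ty r cq I ps with form (rule T r) | bdry (rule T r) | head (rule T r) | cq | rule-inst r I ps
  ... | _ | _ | _ | refl | d = d bdry-ty

  rule-inst-tm : {Γ : VCtx 𝕊 ms n} (r : Rule T) {e : Expr 𝕊 (shape (rule T r)) 0 tm}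
    {A : Expr 𝕊 (shape (rule T r)) 0 ty} →
    concl (rule T r) ≡ (obj tm , bTm A , e) → (I : Inst 𝕊 (shape (rule T r)) ms n) →
    Prems T Θ Γ (prem (rule T r)) I → Derives T Θ Γ (jbase (jTy (I⋆ I A))) →
    Derives T Θ Γ (jbase (jTm (I⋆ I e) (I⋆ I A)))
  rule-inst-tm r cq I ps with form (rule T r) | bdry (rule T r) | head (rule T r) | cq | rule-inst r I ps
  ... | _ | _ | _ | refl | d = d ∘ bdry-tm

  presuppositivity : {Γ : VCtx 𝕊 ms n} {J : Jdg 𝕊 ms n (f , k)} →
    WFVCtx T Θ Γ → Derives T Θ Γ J → DerivesB T Θ Γ (bdryJ J)
  presuppositivity w (var-rule i) = bdry-tm (var-ty w i)
  presuppositivity {Γ = Γ} w (meta-rule p ts a b) =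
    subst (λ X → DerivesB T Θ Γ (bbase X)) (≡-sym (bdryBJ-fillB _ (mhead p ts))) b
  presuppositivity w (meta-congr-ty p ss ts as at es) = bdry-eqTy (meta-ty p ss as) (meta-ty p ts at)
  presuppositivity w (meta-congr-tm p ss ts as at es d) with presuppositivity w d
  ... | bdry-eqTy A B = bdry-eqTm A (meta-tm p ss as A) (conv-tm (meta-tm p ts at B) (eqTy-sym d))
  presuppositivity w (abstr d e) = bdry-abs d (presuppositivity (w ▷ᵛ d) e)
  presuppositivity w (eqTy-refl d) = bdry-eqTy d d
  presuppositivity w (eqTy-sym d) with presuppositivity w d
  ... | bdry-eqTy A B = bdry-eqTy B A
  presuppositivity w (eqTy-trans d e) with presuppositivity w d | presuppositivity w e
  ... | bdry-eqTy A _ | bdry-eqTy _ C = bdry-eqTy A C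
  presuppositivity w (eqTm-refl d) with presuppositivity w d
  ... | bdry-tm A = bdry-eqTm A d d
  presuppositivity w (eqTm-sym d) with presuppositivity w d
  ... | bdry-eqTm A s t = bdry-eqTm A t s
  presuppositivity w (eqTm-trans d e) with presuppositivity w d | presuppositivity w e
  ... | bdry-eqTm A s _ | bdry-eqTm _ _ u = bdry-eqTm A s u
  presuppositivity w (conv-tm d e) with presuppositivity w e
  ... | bdry-eqTy _ B = bdry-tm B
  presuppositivity w (conv-eqTm d e) with presuppositivity w d | presuppositivity w e
  ... | bdry-eqTm _ s t | bdry-eqTy _ B = bdry-eqTm B (conv-tm s e) (conv-tm t e)
  presuppositivity {Γ = Γ} w (rule-inst r I ps b) =
    subst (λ X → DerivesB T Θ Γ (bbase X))
      (≡-sym (bdryBJ-I⋆BJ I (bdry (rule T r)) (head (rule T r)))) b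
  presuppositivity w (rule-congr-ty r cq I J ps qs es) =
    bdry-eqTy (rule-inst-ty r cq I ps) (rule-inst-ty r cq J qs)
  presuppositivity w (rule-congr-tm r cq I J ps qs es d) with presuppositivity w d
  ... | bdry-eqTy A B =
    bdry-eqTm A (rule-inst-tm r cq I ps A) (conv-tm (rule-inst-tm r cq J qs B) (eqTy-sym d))

mainTheorem5 : {𝕊 : Signature} (T : RawTT 𝕊) {ms : List MArity} {n : ℕ} {f : Form} {k : ℕ}
    (Θ : MCtx 𝕊 ms) (Γ : VCtx 𝕊 ms n) (B : Bdry 𝕊 ms n (f , k)) (e : Head 𝕊 ms (n ⊕ k) f) →
    WFMCtx T Θ → WFVCtx T Θ Γ → Derives T Θ Γ (fill B e) → DerivesB T Θ Γ B
mainTheorem5 T Θ Γ B e _ wΓ d = subst (DerivesB T Θ Γ) (bdryJ-fill B e) (presuppositivity wΓ d)
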